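{- Let $(\Gamma,B)$ be a balanced graph in which every vertex has multiplicity $>0$. Then the primitive edges of $\Gamma$ form a system of pairwise vertex-disjoint cycles of $\Gamma$; equivalently, every vertex of $\Gamma$ is incident to either zero or exactly two primitive edges.
   Context: $\mathbb{Z}_2$ denotes the $2$-adic integers and $\nu_2$ the $2$-adic valuation ($\nu_2(0)=\infty$). A $3$-valent graph $\Gamma$ (multiple edges allowed) is regarded as directed by replacing each undirected edge by two opposite directed edges $e^+,e^-$; each vertex is the terminal vertex of exactly three directed edges. A balancing function $B$ assigns to each directed edge a vector $B(e)=(B_x(e),B_y(e))\in\mathbb{Z}_2\oplus\mathbb{Z}_2$ with $B(e^+)+B(e^-)=0$ and $B(e_1)+B(e_2)+B(e_3)=0$ for the three directed edges $e_1,e_2,e_3$ terminating at any vertex; $(\Gamma,B)$ is a balanced graph. The multiplicity of a vertex $v$ with terminating edges $e_1,e_2,e_3$ is $m(v)=\nu_2(B_x(e_1)B_y(e_2)-B_y(e_1)B_x(e_2))\in\mathbb{Z}_{\ge0}\cup\{\infty\}$. A vector of $\mathbb{Z}_2\oplus\mathbb{Z}_2$ is primitive if at least one coordinate is odd; an edge is primitive if its balancing vector is primitive. -}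

module Defs where

open import Data.Nat using (ℕ; zero; suc; _+_; _*_; _∸_; _^_; _≤_; NonZero)
open import Data.Nat.Properties using (m^n≢0; m^n>0; +-∸-comm; +-identityʳ)
open import Data.Nat.DivMod using (_%_; %-distribˡ-+; %-distribˡ-*; [m+n]%n≡m%n)
open import Data.Fin as F using (Fin)
open import Data.Product using (_×_; _,_; proj₁; proj₂)
open import Data.Sum using (_⊎_)
open import Relation.Binary.PropositionalEquality
  using (_≡_; _≢_; refl; sym; trans; cong; cong₂)

-- The 2-adic integers ℤ₂ = lim ℤ/2ⁿℤ.
-- An element is a coherent sequence of natural-number representatives
-- (digits n represents the residue class mod 2ⁿ), and two elements are
-- equal iff all their residues agree.

nz : ∀ n → NonZero (2 ^ n)
nz n = m^n≢0 2 n

infixl 7 _mod2^_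
_mod2^_ : ℕ → ℕ → ℕ
a mod2^ n = _%_ a (2 ^ n) {{nz n}}

record ℤ₂ : Set where
  constructor mkℤ₂
  field
    res    : ℕ → ℕ
    coh    : ∀ n → res (suc n) mod2^ n ≡ res n mod2^ n
open ℤ₂ public

infix 4 _≈_
_≈_ : ℤ₂ → ℤ₂ → Set
x ≈ y = ∀ n → res x n mod2^ n ≡ res y n mod2^ n

private
  cohOp : (_∙_ : ℕ → ℕ → ℕ) →
          (∀ a b d .{{_ : NonZero d}} → (a ∙ b) % d ≡ ((a % d) ∙ (b % d)) % d) →
          (x y : ℤ₂) → ∀ n →
          (res x (suc n) ∙ res y (suc n)) mod2^ n ≡ (res x n ∙ res y n) mod2^ n
  cohOp _∙_ dist x y n =
    trans (dist (res x (suc n)) (res y (suc n)) (2 ^ n) {{nz n}})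
      (trans (cong₂ (λ a b → (a ∙ b) mod2^ n) (coh x n) (coh y n))
        (sym (dist (res x n) (res y n) (2 ^ n) {{nz n}})))

0ℤ₂ : ℤ₂
0ℤ₂ = mkℤ₂ (λ _ → 0) (λ _ → refl)

infixl 6 _+ℤ₂_ _-ℤ₂_
infixl 7 _*ℤ₂_

_+ℤ₂_ : ℤ₂ → ℤ₂ → ℤ₂
x +ℤ₂ y = mkℤ₂ (λ n → res x n + res y n) (cohOp _+_ %-distribˡ-+ x y)

_*ℤ₂_ : ℤ₂ → ℤ₂ → ℤ₂
x *ℤ₂ y = mkℤ₂ (λ n → res x n * res y n) (cohOp _*_ %-distribˡ-* x y)

-1ℤ₂ : ℤ₂
-1ℤ₂ = mkℤ₂ (λ n → 2 ^ n ∸ 1) c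
  where
  c : ∀ n → (2 ^ suc n ∸ 1) mod2^ n ≡ (2 ^ n ∸ 1) mod2^ n
  c n = trans (cong (λ k → k mod2^ n) e) ([m+n]%n≡m%n (2 ^ n ∸ 1) (2 ^ n) {{nz n}})
    where
    e : 2 ^ suc n ∸ 1 ≡ (2 ^ n ∸ 1) + 2 ^ n
    e = trans (cong (λ k → 2 ^ n + k ∸ 1) (+-identityʳ (2 ^ n)))
      (trans (+-∸-comm (2 ^ n) (m^n>0 2 n))
        refl)

-ℤ₂_ : ℤ₂ → ℤ₂
-ℤ₂ x = -1ℤ₂ *ℤ₂ x

_-ℤ₂_ : ℤ₂ → ℤ₂ → ℤ₂
x -ℤ₂ y = x +ℤ₂ (-ℤ₂ y)

-- 2-adic valuation, expressed through its lower bounds: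
-- ν₂ x ≥ k  iff  x ≡ 0 mod 2ᵏ.  (ν₂ 0 = ∞ satisfies every bound.)
ν₂≥ : ℤ₂ → ℕ → Set
ν₂≥ x k = res x k mod2^ k ≡ 0

Odd₂ : ℤ₂ → Set
Odd₂ x = res x 1 mod2^ 1 ≡ 1

Vec₂ : Set
Vec₂ = ℤ₂ × ℤ₂

_ₓ : Vec₂ → ℤ₂
_ₓ = proj₁

_ᵧ : Vec₂ → ℤ₂
_ᵧ = proj₂

infixl 6 _⊕_
_⊕_ : Vec₂ → Vec₂ → Vec₂
(a , b) ⊕ (c , d) = (a +ℤ₂ c , b +ℤ₂ d)

infix 4 _≈₂_
_≈₂_ : Vec₂ → Vec₂ → Set
u ≈₂ v = (u ₓ ≈ v ₓ) × (u ᵧ ≈ v ᵧ)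

0₂ : Vec₂
0₂ = (0ℤ₂ , 0ℤ₂)

Primitive : Vec₂ → Set
Primitive u = Odd₂ (u ₓ) ⊎ Odd₂ (u ᵧ)

det : Vec₂ → Vec₂ → ℤ₂
det u v = (u ₓ *ℤ₂ v ᵧ) -ℤ₂ (u ᵧ *ℤ₂ v ₓ)

-- 3-valent graphs (multiple edges and loops allowed), as directed graphs.  The directed edges terminating at vertex v are
-- indexed by (v , i) with i : Fin 3, so every vertex is the terminal
-- vertex of exactly three directed edges.  `rev` sends a directed edge
-- e⁺ to its opposite e⁻; it is a fixed-point-free involution, and the
-- undirected edges are its orbits.

record Graph3 : Set where
  field
    nV    : ℕ
    rev   : Fin nV × Fin 3 → Fin nV × Fin 3
    rev-invol : ∀ e → rev (rev e) ≡ e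
    rev-free  : ∀ e → rev e ≢ e

  Vertex : Set
  Vertex = Fin nV

  DEdge : Set
  DEdge = Fin nV × Fin 3

  term : DEdge → Vertex
  term = proj₁
open Graph3 public

record IsBalancing (Γ : Graph3) (B : DEdge Γ → Vec₂) : Set where
  field
    antisym : ∀ e → B e ⊕ B (rev Γ e) ≈₂ 0₂
    vertex  : ∀ v → B (v , F.zero) ⊕ B (v , F.suc F.zero)
                      ⊕ B (v , F.suc (F.suc F.zero)) ≈₂ 0₂

-- m(v) > 0, i.e. ν₂(det(B(e₁),B(e₂))) ≥ 1, with e₁ , e₂ the first two
-- directed edges terminating at v.
MultPositive : (Γ : Graph3) → (DEdge Γ → Vec₂) → Vertex Γ → Set
MultPositive Γ B v = ν₂≥ (det (B (v , F.zero)) (B (v , F.suc F.zero))) 1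

-- Reduce everything modulo 2.  The balancing condition says that the three
-- edge vectors at a vertex reduce to u, v, u + v in 𝔽₂², and m(v) > 0 says
-- that det(u, v) vanishes in 𝔽₂, i.e. u = 0, v = 0 or u = v.  Hence the
-- reduced triple is (0, a, a), (a, 0, a) or (a, a, 0), and an edge is
-- primitive exactly when its reduction is nonzero.
module Submission where

open import Defs
open import Data.Fin using (Fin)
open import Data.Fin.Patterns using (0F; 1F; 2F)
open import Data.Nat as ℕ using (ℕ; _%_; parity)
open import Data.Parity.Base as ℙ using (Parity; 0ℙ; 1ℙ)
open import Data.Parity.Properties as ℙ using (+-homo-+; *-homo-*)
open import Data.Product using (_×_; ∃₂; _,_; proj₁; proj₂)
open import Data.Product.Properties using (≡-dec)
open import Data.Sum using (_⊎_; inj₁; inj₂)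
open import Data.Sum.Function.Propositional using (_⊎-⇔_)
open import Function using (_∘′_)
open import Function.Bundles using (_⇔_; mk⇔; Equivalence)
import Function.Properties.Equivalence as ⇔
open import Relation.Binary.Definitions using (DecidableEquality)
open import Relation.Binary.PropositionalEquality
  using (_≡_; _≢_; refl; sym; trans; cong; cong₂; subst; module ≡-Reasoning)
open import Relation.Nullary using (¬_; yes; no; contradiction)

ZeroOrTwo : (Fin 3 → Set) → Set
ZeroOrTwo P = (∀ i → ¬ P i)
  ⊎ (∃₂ λ i j → i ≢ j × P i × P j × (∀ k → P k → k ≡ i ⊎ k ≡ j))

ZeroOrTwo-resp-⇔ : ∀ {P Q : Fin 3 → Set} → (∀ i → P i ⇔ Q i) → ZeroOrTwo P → ZeroOrTwo Q
ZeroOrTwo-resp-⇔ P⇔Q (inj₁ none) = inj₁ λ i → none i ∘′ Equivalence.from (P⇔Q i)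
ZeroOrTwo-resp-⇔ P⇔Q (inj₂ (i , j , i≢j , Pi , Pj , only)) =
  inj₂ (i , j , i≢j , Equivalence.to (P⇔Q i) Pi , Equivalence.to (P⇔Q j) Pj ,
        λ k Qk → only k (Equivalence.from (P⇔Q k) Qk))

zeroOrTwo-≢ : ∀ {A : Set} → DecidableEquality A → (z : A) (t : Fin 3 → A) (i j k : Fin 3) →
  i ≢ j → (∀ l → l ≡ i ⊎ l ≡ j ⊎ l ≡ k) → t k ≡ z → t i ≡ t j → ZeroOrTwo (λ l → t l ≢ z)
zeroOrTwo-≢ _≟_ z t i j k i≢j cover tk≡z ti≡tj with t i ≟ z
... | yes ti≡z = inj₁ λ l tl≢z → tl≢z (vanishes l (cover l))
  where
  vanishes : ∀ l → l ≡ i ⊎ l ≡ j ⊎ l ≡ k → t l ≡ z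
  vanishes _ (inj₁ refl)        = ti≡z
  vanishes _ (inj₂ (inj₁ refl)) = trans (sym ti≡tj) ti≡z
  vanishes _ (inj₂ (inj₂ refl)) = tk≡z
... | no ti≢z = inj₂ (i , j , i≢j , ti≢z , subst (_≢ z) ti≡tj ti≢z , λ l tl≢z → only l tl≢z (cover l))
  where
  only : ∀ l → t l ≢ z → l ≡ i ⊎ l ≡ j ⊎ l ≡ k → l ≡ i ⊎ l ≡ j
  only _ _    (inj₁ l≡i)         = inj₁ l≡i
  only _ _    (inj₂ (inj₁ l≡j))  = inj₂ l≡j
  only _ tl≢z (inj₂ (inj₂ refl)) = contradiction tk≡z tl≢z

Parity² : Set
Parity² = Parity × Parity

0² : Parity²
0² = 0ℙ , 0ℙ

infixl 6 _+²_
_+²_ : Parity² → Parity² → Parity²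
(a , b) +² (c , d) = a ℙ.+ c , b ℙ.+ d

det² : Parity² → Parity² → Parity
det² (a , b) (c , d) = (a ℙ.* d) ℙ.+ (b ℙ.* c)

_≟²_ : DecidableEquality Parity²
_≟²_ = ≡-dec ℙ._≟_ ℙ._≟_

third≡sum : ∀ a b c → a ℙ.+ b ℙ.+ c ≡ 0ℙ → c ≡ a ℙ.+ b
third≡sum a b c a+b+c≡0 = begin
  c                             ≡⟨ sym (cong (ℙ._+ c) (ℙ.p+p≡0ℙ (a ℙ.+ b))) ⟩
  (a ℙ.+ b) ℙ.+ (a ℙ.+ b) ℙ.+ c ≡⟨ ℙ.+-assoc (a ℙ.+ b) (a ℙ.+ b) c ⟩
  (a ℙ.+ b) ℙ.+ (a ℙ.+ b ℙ.+ c) ≡⟨ cong ((a ℙ.+ b) ℙ.+_) a+b+c≡0 ⟩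
  (a ℙ.+ b) ℙ.+ 0ℙ              ≡⟨ ℙ.+-identityʳ (a ℙ.+ b) ⟩
  a ℙ.+ b                       ∎
  where open ≡-Reasoning

third≡sum² : ∀ u v w → u +² v +² w ≡ 0² → w ≡ u +² v
third≡sum² (a , b) (c , d) (e , f) sum≡0 =
  cong₂ _,_ (third≡sum a c e (cong proj₁ sum≡0)) (third≡sum b d f (cong proj₂ sum≡0))

+²-identityʳ : ∀ u → u +² 0² ≡ u
+²-identityʳ (a , b) = cong₂ _,_ (ℙ.+-identityʳ a) (ℙ.+-identityʳ b)

u+²u≡0² : ∀ u → u +² u ≡ 0²
u+²u≡0² (a , b) = cong₂ _,_ (ℙ.p+p≡0ℙ a) (ℙ.p+p≡0ℙ b)

det²≡0ℙ⇒dependent : ∀ u v → det² u v ≡ 0ℙ → u ≡ 0² ⊎ v ≡ 0² ⊎ u ≡ v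
det²≡0ℙ⇒dependent (0ℙ , 0ℙ) v         _  = inj₁ refl
det²≡0ℙ⇒dependent u         (0ℙ , 0ℙ) _  = inj₂ (inj₁ refl)
det²≡0ℙ⇒dependent (0ℙ , 1ℙ) (0ℙ , 1ℙ) _  = inj₂ (inj₂ refl)
det²≡0ℙ⇒dependent (1ℙ , 0ℙ) (1ℙ , 0ℙ) _  = inj₂ (inj₂ refl)
det²≡0ℙ⇒dependent (1ℙ , 1ℙ) (1ℙ , 1ℙ) _  = inj₂ (inj₂ refl)
det²≡0ℙ⇒dependent (0ℙ , 1ℙ) (1ℙ , _)  ()
det²≡0ℙ⇒dependent (1ℙ , 0ℙ) (0ℙ , 1ℙ) ()
det²≡0ℙ⇒dependent (1ℙ , 1ℙ) (0ℙ , 1ℙ) ()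
det²≡0ℙ⇒dependent (1ℙ , 0ℙ) (1ℙ , 1ℙ) ()
det²≡0ℙ⇒dependent (1ℙ , 1ℙ) (1ℙ , 0ℙ) ()

zeroOrTwo-dependent : (t : Fin 3 → Parity²) → t 2F ≡ t 0F +² t 1F →
  t 0F ≡ 0² ⊎ t 1F ≡ 0² ⊎ t 0F ≡ t 1F → ZeroOrTwo (λ i → t i ≢ 0²)
zeroOrTwo-dependent t t₂≡t₀+t₁ (inj₁ t₀≡0) =
  zeroOrTwo-≢ _≟²_ 0² t 1F 2F 0F (λ ())
    (λ { 0F → inj₂ (inj₂ refl) ; 1F → inj₁ refl ; 2F → inj₂ (inj₁ refl) })
    t₀≡0 (sym (trans t₂≡t₀+t₁ (cong (_+² t 1F) t₀≡0)))
zeroOrTwo-dependent t t₂≡t₀+t₁ (inj₂ (inj₁ t₁≡0)) =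
  zeroOrTwo-≢ _≟²_ 0² t 0F 2F 1F (λ ())
    (λ { 0F → inj₁ refl ; 1F → inj₂ (inj₂ refl) ; 2F → inj₂ (inj₁ refl) })
    t₁≡0 (sym (trans t₂≡t₀+t₁ (trans (cong (t 0F +²_) t₁≡0) (+²-identityʳ (t 0F)))))
zeroOrTwo-dependent t t₂≡t₀+t₁ (inj₂ (inj₂ t₀≡t₁)) =
  zeroOrTwo-≢ _≟²_ 0² t 0F 1F 2F (λ ())
    (λ { 0F → inj₁ refl ; 1F → inj₂ (inj₁ refl) ; 2F → inj₂ (inj₂ refl) })
    (trans t₂≡t₀+t₁ (trans (cong (t 0F +²_) (sym t₀≡t₁)) (u+²u≡0² (t 0F)))) t₀≡t₁

zeroOrTwo-≢0² : (t : Fin 3 → Parity²) → t 0F +² t 1F +² t 2F ≡ 0² →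
  det² (t 0F) (t 1F) ≡ 0ℙ → ZeroOrTwo (λ i → t i ≢ 0²)
zeroOrTwo-≢0² t sum≡0 det≡0 =
  zeroOrTwo-dependent t (third≡sum² (t 0F) (t 1F) (t 2F) sum≡0)
    (det²≡0ℙ⇒dependent (t 0F) (t 1F) det≡0)

toℕ : Parity → ℕ
toℕ 0ℙ = 0
toℕ 1ℙ = 1

toℕ-injective : ∀ {p q} → toℕ p ≡ toℕ q → p ≡ q
toℕ-injective {0ℙ} {0ℙ} _ = refl
toℕ-injective {1ℙ} {1ℙ} _ = refl

n%2≡toℕ-parity : ∀ n → n % 2 ≡ toℕ (parity n)
n%2≡toℕ-parity 0                 = refl
n%2≡toℕ-parity 1                 = refl
n%2≡toℕ-parity (ℕ.suc (ℕ.suc n)) = n%2≡toℕ-parity n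

parity₂ : ℤ₂ → Parity
parity₂ x = parity (res x 1)

parity₂-cong : ∀ {x y} → x ≈ y → parity₂ x ≡ parity₂ y
parity₂-cong {x} {y} x≈y = toℕ-injective (begin
  toℕ (parity₂ x)  ≡⟨ sym (n%2≡toℕ-parity (res x 1)) ⟩
  res x 1 % 2      ≡⟨ x≈y 1 ⟩
  res y 1 % 2      ≡⟨ n%2≡toℕ-parity (res y 1) ⟩
  toℕ (parity₂ y)  ∎)
  where open ≡-Reasoning

parity₂-+ : ∀ x y → parity₂ (x +ℤ₂ y) ≡ parity₂ x ℙ.+ parity₂ y
parity₂-+ x y = +-homo-+ (res x 1) (res y 1)

parity₂-* : ∀ x y → parity₂ (x *ℤ₂ y) ≡ parity₂ x ℙ.* parity₂ y
parity₂-* x y = *-homo-* (res x 1) (res y 1)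

-- The residue of -1 modulo 2 is 2¹ ∸ 1 = 1, so negation is invisible mod 2.
parity₂-- : ∀ x y → parity₂ (x -ℤ₂ y) ≡ parity₂ x ℙ.+ parity₂ y
parity₂-- x y = trans (parity₂-+ x (-ℤ₂ y)) (cong (parity₂ x ℙ.+_) (*-homo-* 1 (res y 1)))

ν₂≥1⇒parity₂≡0ℙ : ∀ x → ν₂≥ x 1 → parity₂ x ≡ 0ℙ
ν₂≥1⇒parity₂≡0ℙ x even = toℕ-injective (trans (sym (n%2≡toℕ-parity (res x 1))) even)

Odd₂⇔parity₂≡1ℙ : ∀ x → Odd₂ x ⇔ parity₂ x ≡ 1ℙ
Odd₂⇔parity₂≡1ℙ x = mk⇔
  (λ odd → toℕ-injective (trans (sym (n%2≡toℕ-parity (res x 1))) odd))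
  (λ p≡1 → trans (n%2≡toℕ-parity (res x 1)) (cong toℕ p≡1))

parity² : Vec₂ → Parity²
parity² u = parity₂ (u ₓ) , parity₂ (u ᵧ)

parity²-cong : ∀ {u v} → u ≈₂ v → parity² u ≡ parity² v
parity²-cong {u} {v} (uₓ≈vₓ , uᵧ≈vᵧ) =
  cong₂ _,_ (parity₂-cong {u ₓ} {v ₓ} uₓ≈vₓ) (parity₂-cong {u ᵧ} {v ᵧ} uᵧ≈vᵧ)

parity²-⊕ : ∀ u v → parity² (u ⊕ v) ≡ parity² u +² parity² v
parity²-⊕ (a , b) (c , d) = cong₂ _,_ (parity₂-+ a c) (parity₂-+ b d)

parity₂-det : ∀ u v → parity₂ (det u v) ≡ det² (parity² u) (parity² v)
parity₂-det (a , b) (c , d) = begin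
  parity₂ ((a *ℤ₂ d) -ℤ₂ (b *ℤ₂ c))                ≡⟨ parity₂-- (a *ℤ₂ d) (b *ℤ₂ c) ⟩
  parity₂ (a *ℤ₂ d) ℙ.+ parity₂ (b *ℤ₂ c)          ≡⟨ cong₂ ℙ._+_ (parity₂-* a d) (parity₂-* b c) ⟩
  (parity₂ a ℙ.* parity₂ d) ℙ.+ (parity₂ b ℙ.* parity₂ c) ∎
  where open ≡-Reasoning

≡1ℙ⊎≡1ℙ⇔≢0² : ∀ p q → (p ≡ 1ℙ ⊎ q ≡ 1ℙ) ⇔ (p , q) ≢ 0²
≡1ℙ⊎≡1ℙ⇔≢0² p q = mk⇔ to (from p q)
  where
  to : p ≡ 1ℙ ⊎ q ≡ 1ℙ → (p , q) ≢ 0²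
  to (inj₁ refl) ()
  to (inj₂ refl) ()
  from : ∀ p q → (p , q) ≢ 0² → p ≡ 1ℙ ⊎ q ≡ 1ℙ
  from 0ℙ 0ℙ ≢0 = contradiction refl ≢0
  from 0ℙ 1ℙ _  = inj₂ refl
  from 1ℙ _  _  = inj₁ refl

Primitive⇔parity²≢0² : ∀ u → Primitive u ⇔ parity² u ≢ 0²
Primitive⇔parity²≢0² (a , b) =
  ⇔.trans (Odd₂⇔parity₂≡1ℙ a ⊎-⇔ Odd₂⇔parity₂≡1ℙ b) (≡1ℙ⊎≡1ℙ⇔≢0² (parity₂ a) (parity₂ b))

corollary2 : (Γ : Graph3) (B : DEdge Γ → Vec₂) → IsBalancing Γ B →
    (∀ v → MultPositive Γ B v) →
    ∀ (v : Vertex Γ) →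
      (∀ (i : Fin 3) → ¬ Primitive (B (v , i)))
      ⊎ (∃₂ λ (i j : Fin 3) → i ≢ j × Primitive (B (v , i)) × Primitive (B (v , j))
           × (∀ k → Primitive (B (v , k)) → k ≡ i ⊎ k ≡ j))
corollary2 Γ B balanced multPositive v =
  ZeroOrTwo-resp-⇔ (λ i → ⇔.sym (Primitive⇔parity²≢0² (B (v , i))))
    (zeroOrTwo-≢0² (λ i → parity² (B (v , i))) sum≡0 det≡0)
  where
  open IsBalancing balanced
  b₀ b₁ b₂ : Vec₂
  b₀ = B (v , 0F)
  b₁ = B (v , 1F)
  b₂ = B (v , 2F)
  sum≡0 : parity² b₀ +² parity² b₁ +² parity² b₂ ≡ 0²
  sum≡0 = begin
    parity² b₀ +² parity² b₁ +² parity² b₂ ≡⟨ cong (_+² parity² b₂) (sym (parity²-⊕ b₀ b₁)) ⟩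
    parity² (b₀ ⊕ b₁) +² parity² b₂        ≡⟨ sym (parity²-⊕ (b₀ ⊕ b₁) b₂) ⟩
    parity² (b₀ ⊕ b₁ ⊕ b₂)                 ≡⟨ parity²-cong {b₀ ⊕ b₁ ⊕ b₂} {0₂} (vertex v) ⟩
    0²                                     ∎
    where open ≡-Reasoning
  det≡0 : det² (parity² b₀) (parity² b₁) ≡ 0ℙ
  det≡0 = trans (sym (parity₂-det b₀ b₁)) (ν₂≥1⇒parity₂≡0ℙ (det b₀ b₁) (multPositive v))
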